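{- Let $q$ be a prime power, $n\ge 2$ and $k\ge1$ integers, and $P=\{A^k+B^k\mid A,B\in M_n(\mathbb F_q)\}$. If $L_P\supseteq SL_n(\mathbb F_q)$, then $P=M_n(\mathbb F_q)$.
   Context: For a nonempty subset $S\subset M_n(\mathbb F_q)$, $L_S=\{g\in GL_n(\mathbb F_q)\mid gS=S\}$, where $gS=\{gs\mid s\in S\}$. -}

module Defs where

open import Level using (Level; _⊔_)
open import Data.Nat using (ℕ; zero; suc)
open import Data.Fin using (Fin; zero; suc; punchIn)
open import Data.Product using (Σ; _×_; ∃)
open import Relation.Nullary using (¬_; does)
open import Relation.Binary.PropositionalEquality using (_≡_)
open import Data.Bool using (true; false)
import Data.Fin as F
open import Algebra.Bundles using (CommutativeRing)

-- Its order q is then automatically a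
-- prime power, and every prime power arises; F_q is unique up to isomorphism.
record FiniteField (c ℓ : Level) : Set (Level.suc (c ⊔ ℓ)) where
  field
    commRing : CommutativeRing c ℓ
  open CommutativeRing commRing public
  field
    0≉1      : ¬ (0# ≈ 1#)
    inverse  : ∀ x → ¬ (x ≈ 0#) → ∃ λ y → x * y ≈ 1#
    order    : ℕ
    enum     : Fin order → Carrier
    enum-surj : ∀ x → ∃ λ i → enum i ≈ x
    enum-inj  : ∀ i j → enum i ≈ enum j → i ≡ j

module Matrices {c ℓ : Level} (F : FiniteField c ℓ) where
  open FiniteField F using (Carrier; _≈_; _+_; _*_; _-_; 0#; 1#)

  Mat : ℕ → Set c
  Mat n = Fin n → Fin n → Carrier

  _≈M_ : ∀ {n} → Mat n → Mat n → Set ℓ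
  A ≈M B = ∀ i j → A i j ≈ B i j

  Σ[_] : ∀ n → (Fin n → Carrier) → Carrier
  Σ[ zero ]  f = 0#
  Σ[ suc n ] f = f zero + Σ[ n ] (λ i → f (suc i))

  _+M_ : ∀ {n} → Mat n → Mat n → Mat n
  (A +M B) i j = A i j + B i j

  _*M_ : ∀ {n} → Mat n → Mat n → Mat n
  _*M_ {n} A B i j = Σ[ n ] (λ l → A i l * B l j)

  I : ∀ {n} → Mat n
  I i j with does (i F.≟ j)
  ... | true  = 1#
  ... | false = 0#

  _^M_ : ∀ {n} → Mat n → ℕ → Mat n
  A ^M zero  = I
  A ^M suc k = A *M (A ^M k)

  altΣ : ∀ n → (Fin n → Carrier) → Carrier
  altΣ zero    f = 0#
  altΣ (suc n) f = f zero - altΣ n (λ i → f (suc i))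

  det : ∀ {n} → Mat n → Carrier
  det {zero}  A = 1#
  det {suc n} A = altΣ (suc n) (λ j → A zero j * det (λ r s → A (suc r) (punchIn j s)))

  GL : ∀ {n} → Mat n → Set (c ⊔ ℓ)
  GL {n} g = Σ (Mat n) λ h → ((g *M h) ≈M I) × ((h *M g) ≈M I)

  SL : ∀ {n} → Mat n → Set ℓ
  SL g = det g ≈ 1#

  _·_==_ : ∀ {n} → Mat n → (Mat n → Set (c ⊔ ℓ)) → (Mat n → Set (c ⊔ ℓ)) → Set (c ⊔ ℓ)
  _·_==_ {n} g S T = (∀ s → S s → ∃ λ t → T t × ((g *M s) ≈M t))
                   × (∀ t → T t → ∃ λ s → S s × ((g *M s) ≈M t))

  L : ∀ {n} → (Mat n → Set (c ⊔ ℓ)) → Mat n → Set (c ⊔ ℓ)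
  L S g = GL g × (g · S == S)

  P : ∀ {n} → ℕ → Mat n → Set (c ⊔ ℓ)
  P {n} k M = ∃ λ A → ∃ λ (B : Mat n) → M ≈M ((A ^M k) +M (B ^M k))

{-# OPTIONS --safe #-}
module Submission where

-- Left multiplication by SL_n preserves P, and conjugation by an invertible
-- matrix maps sums of k-th powers to sums of k-th powers; hence membership in P
-- is invariant under SL_n row and column operations.  Gaussian elimination with
-- such operations brings every matrix to diag(d, e₁, …, e_{n-1}) with all
-- eᵢ ∈ {0, 1}.  Idempotents are k-th powers, and such a diagonal matrix is an
-- SL_n-multiple of a sum of two idempotents: for e₁ = 0 it is
-- diag(d, d⁻¹, 1, …, 1) · diag(1, 0, e₂, …) (or itself idempotent if d = 0),
-- and for e₁ = 1 it is obtained from diag(0, 1, e₂, …) + R, R a rank-one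
-- idempotent, by two elementary operations.

open import Defs
open import Level using (Level; _⊔_)
open import Data.Nat using (ℕ; zero; suc; _≤_; s≤s; z≤n)
open import Data.Fin using (Fin; zero; suc; punchIn)
import Data.Fin.Properties as FinP
open import Data.Vec.Functional using (_∷_)
open import Data.Product using (_×_; ∃; ∃₂; _,_)
open import Data.Sum using (_⊎_; inj₁; inj₂)
open import Data.Empty using (⊥-elim)
open import Relation.Nullary using (¬_; Dec; yes; no; ¬?)
open import Relation.Nullary.Decidable using (decidable-stable)
import Relation.Binary.PropositionalEquality as ≡
open import Relation.Binary.Bundles using (Setoid)
open import Relation.Binary.Construct.Closure.ReflexiveTransitive
  using (Star; ε; _◅_; _◅◅_; gmap)
import Relation.Binary.Reasoning.Setoid as SetoidReasoning
import Algebra.Properties.Ring as RingProperties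
import Algebra.Properties.CommutativeSemigroup as CommutativeSemigroupProperties

module MatrixAlgebra {c ℓ : Level} (F : FiniteField c ℓ) where
  open FiniteField F hiding (zero)
  open Matrices F
  open RingProperties ring using (-0#≈0#)
  open CommutativeSemigroupProperties +-commutativeSemigroup using (interchange)

  _≟_ : (x y : Carrier) → Dec (x ≈ y)
  x ≟ y with enum-surj x | enum-surj y
  ... | i , ei | j , ej with i FinP.≟ j
  ... | yes ≡.refl = yes (trans (sym ei) ej)
  ... | no i≢j = no λ x≈y → i≢j (enum-inj i j (trans ei (trans x≈y (sym ej))))

  x-0#≈x : ∀ x → x - 0# ≈ x
  x-0#≈x x = trans (+-cong refl -0#≈0#) (+-identityʳ x)

  Σ-cong : ∀ {n} {f g : Fin n → Carrier} → (∀ i → f i ≈ g i) → Σ[ n ] f ≈ Σ[ n ] g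
  Σ-cong {zero}  f≈g = refl
  Σ-cong {suc n} f≈g = +-cong (f≈g zero) (Σ-cong (λ i → f≈g (suc i)))

  Σ-≈0# : ∀ {n} {f : Fin n → Carrier} → (∀ i → f i ≈ 0#) → Σ[ n ] f ≈ 0#
  Σ-≈0# {zero}  f≈0 = refl
  Σ-≈0# {suc n} f≈0 = trans (+-cong (f≈0 zero) (Σ-≈0# (λ i → f≈0 (suc i)))) (+-identityʳ 0#)

  Σ-+ : ∀ {n} (f g : Fin n → Carrier) → Σ[ n ] (λ i → f i + g i) ≈ Σ[ n ] f + Σ[ n ] g
  Σ-+ {zero}  f g = sym (+-identityʳ 0#)
  Σ-+ {suc n} f g = trans (+-cong refl (Σ-+ (λ i → f (suc i)) (λ i → g (suc i))))
                          (interchange (f zero) (g zero) _ _)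

  *-distribˡ-Σ : ∀ {n} x (f : Fin n → Carrier) → x * Σ[ n ] f ≈ Σ[ n ] (λ i → x * f i)
  *-distribˡ-Σ {zero}  x f = zeroʳ x
  *-distribˡ-Σ {suc n} x f = trans (distribˡ x _ _) (+-cong refl (*-distribˡ-Σ x (λ i → f (suc i))))

  *-distribʳ-Σ : ∀ {n} x (f : Fin n → Carrier) → Σ[ n ] f * x ≈ Σ[ n ] (λ i → f i * x)
  *-distribʳ-Σ {zero}  x f = zeroˡ x
  *-distribʳ-Σ {suc n} x f = trans (distribʳ x _ _) (+-cong refl (*-distribʳ-Σ x (λ i → f (suc i))))

  Σ-comm : ∀ {n m} (f : Fin n → Fin m → Carrier) →
           Σ[ n ] (λ i → Σ[ m ] (f i)) ≈ Σ[ m ] (λ j → Σ[ n ] (λ i → f i j))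
  Σ-comm {zero}  {m} f = sym (Σ-≈0# {m} (λ j → refl))
  Σ-comm {suc n} {m} f = trans (+-cong refl (Σ-comm (λ i → f (suc i))))
                               (sym (Σ-+ (f zero) (λ j → Σ[ n ] (λ i → f (suc i) j))))

  I-suc : ∀ {n} (i j : Fin n) → I (suc i) (suc j) ≈ I i j
  I-suc i j with i FinP.≟ j
  ... | yes _ = refl
  ... | no  _ = refl

  Σ-selectˡ : ∀ {n} (r : Fin n) (f : Fin n → Carrier) → Σ[ n ] (λ l → I r l * f l) ≈ f r
  Σ-selectˡ {suc n} zero f =
    trans (+-cong (*-identityˡ (f zero)) (Σ-≈0# {n} (λ i → zeroˡ _))) (+-identityʳ _)
  Σ-selectˡ {suc n} (suc r) f =
    trans (+-cong (zeroˡ _) (trans (Σ-cong {n} (λ l → *-cong (I-suc r l) refl))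
                                   (Σ-selectˡ r (λ l → f (suc l)))))
          (+-identityˡ _)

  Σ-selectʳ : ∀ {n} (r : Fin n) (f : Fin n → Carrier) → Σ[ n ] (λ l → f l * I l r) ≈ f r
  Σ-selectʳ {suc n} zero f =
    trans (+-cong (*-identityʳ (f zero)) (Σ-≈0# {n} (λ i → zeroʳ _))) (+-identityʳ _)
  Σ-selectʳ {suc n} (suc r) f =
    trans (+-cong (zeroʳ _) (trans (Σ-cong {n} (λ l → *-cong refl (I-suc l r)))
                                   (Σ-selectʳ r (λ l → f (suc l)))))
          (+-identityˡ _)

  ≈M-setoid : ℕ → Setoid c ℓ
  ≈M-setoid n = record
    { Carrier = Mat n
    ; _≈_ = _≈M_
    ; isEquivalence = record
      { refl  = λ i j → refl
      ; sym   = λ A≈B i j → sym (A≈B i j)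
      ; trans = λ A≈B B≈C i j → trans (A≈B i j) (B≈C i j)
      }
    }

  module _ {n : ℕ} where
    open Setoid (≈M-setoid n) public
      using () renaming (refl to ≈M-refl; sym to ≈M-sym; trans to ≈M-trans)

  *M-cong : ∀ {n} {A A′ B B′ : Mat n} → A ≈M A′ → B ≈M B′ → (A *M B) ≈M (A′ *M B′)
  *M-cong A≈A′ B≈B′ i j = Σ-cong (λ l → *-cong (A≈A′ i l) (B≈B′ l j))

  +M-cong : ∀ {n} {A A′ B B′ : Mat n} → A ≈M A′ → B ≈M B′ → (A +M B) ≈M (A′ +M B′)
  +M-cong A≈A′ B≈B′ i j = +-cong (A≈A′ i j) (B≈B′ i j)

  *M-assoc : ∀ {n} (A B C : Mat n) → ((A *M B) *M C) ≈M (A *M (B *M C))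
  *M-assoc {n} A B C i j = begin
    Σ[ n ] (λ l → Σ[ n ] (λ m → A i m * B m l) * C l j)
      ≈⟨ Σ-cong (λ l → *-distribʳ-Σ (C l j) (λ m → A i m * B m l)) ⟩
    Σ[ n ] (λ l → Σ[ n ] (λ m → A i m * B m l * C l j))
      ≈⟨ Σ-comm (λ l m → A i m * B m l * C l j) ⟩
    Σ[ n ] (λ m → Σ[ n ] (λ l → A i m * B m l * C l j))
      ≈⟨ Σ-cong (λ m → Σ-cong {n} (λ l → *-assoc (A i m) (B m l) (C l j))) ⟩
    Σ[ n ] (λ m → Σ[ n ] (λ l → A i m * (B m l * C l j)))
      ≈⟨ Σ-cong (λ m → sym (*-distribˡ-Σ (A i m) (λ l → B m l * C l j))) ⟩
    Σ[ n ] (λ m → A i m * Σ[ n ] (λ l → B m l * C l j)) ∎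
    where open SetoidReasoning setoid

  *M-identityˡ : ∀ {n} (A : Mat n) → (I *M A) ≈M A
  *M-identityˡ A i j = Σ-selectˡ i (λ l → A l j)

  *M-identityʳ : ∀ {n} (A : Mat n) → (A *M I) ≈M A
  *M-identityʳ A i j = Σ-selectʳ j (λ l → A i l)

  *M-distribˡ-+M : ∀ {n} (A B C : Mat n) → (A *M (B +M C)) ≈M ((A *M B) +M (A *M C))
  *M-distribˡ-+M {n} A B C i j =
    trans (Σ-cong {n} (λ l → distribˡ _ _ _)) (Σ-+ (λ l → A i l * B l j) (λ l → A i l * C l j))

  *M-distribʳ-+M : ∀ {n} (A B C : Mat n) → ((B +M C) *M A) ≈M ((B *M A) +M (C *M A))
  *M-distribʳ-+M {n} A B C i j =
    trans (Σ-cong {n} (λ l → distribʳ _ _ _)) (Σ-+ (λ l → B i l * A l j) (λ l → C i l * A l j))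

  *M-cancelˡ : ∀ {n} {g g′ X Y : Mat n} → (g′ *M g) ≈M I → (g *M X) ≈M (g *M Y) → X ≈M Y
  *M-cancelˡ {n} {g} {g′} {X} {Y} g′g≈I gX≈gY = begin
    X               ≈⟨ *M-identityˡ X ⟨
    I *M X          ≈⟨ *M-cong g′g≈I ≈M-refl ⟨
    (g′ *M g) *M X  ≈⟨ *M-assoc g′ g X ⟩
    g′ *M (g *M X)  ≈⟨ *M-cong ≈M-refl gX≈gY ⟩
    g′ *M (g *M Y)  ≈⟨ *M-assoc g′ g Y ⟨
    (g′ *M g) *M Y  ≈⟨ *M-cong g′g≈I ≈M-refl ⟩
    I *M Y          ≈⟨ *M-identityˡ Y ⟩
    Y ∎
    where open SetoidReasoning (≈M-setoid n)

  ^M-conj : ∀ {n} {h h′ : Mat n} → (h *M h′) ≈M I → (h′ *M h) ≈M I →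
            ∀ A k → ((h′ *M (A *M h)) ^M k) ≈M (h′ *M ((A ^M k) *M h))
  ^M-conj {h = h} {h′} hh′≈I h′h≈I A zero =
    ≈M-sym (≈M-trans (*M-cong ≈M-refl (*M-identityˡ h)) h′h≈I)
  ^M-conj {n} {h} {h′} hh′≈I h′h≈I A (suc k) = begin
    (h′ *M (A *M h)) *M ((h′ *M (A *M h)) ^M k)
      ≈⟨ *M-cong ≈M-refl (^M-conj hh′≈I h′h≈I A k) ⟩
    (h′ *M (A *M h)) *M (h′ *M ((A ^M k) *M h))
      ≈⟨ *M-assoc h′ (A *M h) _ ⟩
    h′ *M ((A *M h) *M (h′ *M ((A ^M k) *M h)))
      ≈⟨ *M-cong ≈M-refl (*M-assoc A h _) ⟩
    h′ *M (A *M (h *M (h′ *M ((A ^M k) *M h))))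
      ≈⟨ *M-cong ≈M-refl (*M-cong ≈M-refl (≈M-sym (*M-assoc h h′ _))) ⟩
    h′ *M (A *M ((h *M h′) *M ((A ^M k) *M h)))
      ≈⟨ *M-cong ≈M-refl (*M-cong ≈M-refl (≈M-trans (*M-cong hh′≈I ≈M-refl) (*M-identityˡ _))) ⟩
    h′ *M (A *M ((A ^M k) *M h))
      ≈⟨ *M-cong ≈M-refl (≈M-sym (*M-assoc A (A ^M k) h)) ⟩
    h′ *M ((A ^M suc k) *M h) ∎
    where open SetoidReasoning (≈M-setoid n)

  altΣ-cong : ∀ {n} {f g : Fin n → Carrier} → (∀ i → f i ≈ g i) → altΣ n f ≈ altΣ n g
  altΣ-cong {zero}  f≈g = refl
  altΣ-cong {suc n} f≈g = +-cong (f≈g zero) (-‿cong (altΣ-cong (λ i → f≈g (suc i))))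

  altΣ-≈0# : ∀ {n} {f : Fin n → Carrier} → (∀ i → f i ≈ 0#) → altΣ n f ≈ 0#
  altΣ-≈0# {zero}  f≈0 = refl
  altΣ-≈0# {suc n} f≈0 =
    trans (+-cong (f≈0 zero) (-‿cong (altΣ-≈0# (λ i → f≈0 (suc i))))) (x-0#≈x 0#)

  altΣ-head : ∀ {n} (f : Fin (suc n) → Carrier) → (∀ j → f (suc j) ≈ 0#) → altΣ (suc n) f ≈ f zero
  altΣ-head f tail≈0 = trans (+-cong refl (-‿cong (altΣ-≈0# tail≈0))) (x-0#≈x _)

  det-cong : ∀ {n} {A B : Mat n} → A ≈M B → det A ≈ det B
  det-cong {zero}  A≈B = refl
  det-cong {suc n} A≈B =
    altΣ-cong (λ j → *-cong (A≈B zero j) (det-cong (λ r s → A≈B (suc r) (punchIn j s))))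

  minor : ∀ {n} → Mat (suc n) → Mat n
  minor A r s = A (suc r) (suc s)

  laplaceTerm : ∀ {n} → Mat (suc n) → Fin (suc n) → Carrier
  laplaceTerm A j = A zero j * det (λ r s → A (suc r) (punchIn j s))

  det-zeroColumn : ∀ {n} (A : Mat (suc n)) → (∀ r → A r zero ≈ 0#) → det A ≈ 0#
  det-zeroColumn A col≈0 = altΣ-≈0# laplaceTerm≈0
    where
    laplaceTerm≈0 : ∀ j → laplaceTerm A j ≈ 0#
    laplaceTerm≈0 zero = trans (*-cong (col≈0 zero) refl) (zeroˡ _)
    laplaceTerm≈0 (suc {suc _} j) =
      trans (*-cong refl (det-zeroColumn (λ r s → A (suc r) (punchIn (suc j) s)) (λ r → col≈0 (suc r))))
            (zeroʳ _)

  det-zeroFirstRow : ∀ {n} (A : Mat (suc n)) → (∀ j → A zero (suc j) ≈ 0#) →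
                     det A ≈ A zero zero * det (minor A)
  det-zeroFirstRow A row≈0 =
    altΣ-head (laplaceTerm A) (λ j → trans (*-cong (row≈0 j) refl) (zeroˡ _))

  det-zeroFirstColumn : ∀ {n} (A : Mat (suc n)) → (∀ r → A (suc r) zero ≈ 0#) →
                        det A ≈ A zero zero * det (minor A)
  det-zeroFirstColumn {zero}  A col≈0 = altΣ-head (laplaceTerm A) λ ()
  det-zeroFirstColumn {suc n} A col≈0 = altΣ-head (laplaceTerm A) λ j →
    trans (*-cong refl (det-zeroColumn (λ r s → A (suc r) (punchIn (suc j) s)) col≈0)) (zeroʳ _)

  SL-I : ∀ {n} → SL (I {n})
  SL-I {zero}  = refl
  SL-I {suc n} = trans (det-zeroFirstRow (I {suc n}) (λ j → refl))
                        (trans (*-identityˡ _) (trans (det-cong {n} I-suc) (SL-I {n})))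

  infixr 5 _⊕_
  _⊕_ : ∀ {n} → Carrier → Mat n → Mat (suc n)
  (a ⊕ Y) zero    zero    = a
  (a ⊕ Y) zero    (suc s) = 0#
  (a ⊕ Y) (suc r) zero    = 0#
  (a ⊕ Y) (suc r) (suc s) = Y r s

  ⊕-cong : ∀ {n} {a b} {Y Z : Mat n} → a ≈ b → Y ≈M Z → (a ⊕ Y) ≈M (b ⊕ Z)
  ⊕-cong a≈b Y≈Z zero    zero    = a≈b
  ⊕-cong a≈b Y≈Z zero    (suc s) = refl
  ⊕-cong a≈b Y≈Z (suc r) zero    = refl
  ⊕-cong a≈b Y≈Z (suc r) (suc s) = Y≈Z r s

  ⊕-*M : ∀ {n} a b (Y Z : Mat n) → ((a ⊕ Y) *M (b ⊕ Z)) ≈M ((a * b) ⊕ (Y *M Z))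
  ⊕-*M {n} a b Y Z zero    zero    = trans (+-cong refl (Σ-≈0# {n} (λ l → zeroˡ _))) (+-identityʳ _)
  ⊕-*M {n} a b Y Z zero    (suc s) = trans (+-cong (zeroʳ a) (Σ-≈0# {n} (λ l → zeroˡ _))) (+-identityʳ _)
  ⊕-*M {n} a b Y Z (suc r) zero    = trans (+-cong (zeroˡ b) (Σ-≈0# {n} (λ l → zeroʳ _))) (+-identityʳ _)
  ⊕-*M {n} a b Y Z (suc r) (suc s) = trans (+-cong (zeroˡ _) refl) (+-identityˡ _)

  det-⊕ : ∀ {n} a (Y : Mat n) → det (a ⊕ Y) ≈ a * det Y
  det-⊕ a Y = det-zeroFirstRow (a ⊕ Y) (λ j → refl)

  SL-1#⊕ : ∀ {n} (g : Mat n) → SL g → SL (1# ⊕ g)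
  SL-1#⊕ g g∈SL = trans (det-⊕ 1# g) (trans (*-identityˡ _) g∈SL)

  diag : ∀ {n} → (Fin n → Carrier) → Mat n
  diag {zero}  e = λ ()
  diag {suc n} e = e zero ⊕ diag (λ i → e (suc i))

  lower : ∀ {n} → (Fin n → Carrier) → Mat (suc n)
  lower v zero    zero    = 1#
  lower v zero    (suc s) = 0#
  lower v (suc r) zero    = v r
  lower v (suc r) (suc s) = I r s

  upper : ∀ {n} → (Fin n → Carrier) → Mat (suc n)
  upper w zero    zero    = 1#
  upper w zero    (suc s) = w s
  upper w (suc r) zero    = 0#
  upper w (suc r) (suc s) = I r s

  SL-lower : ∀ {n} (v : Fin n → Carrier) → SL (lower v)
  SL-lower {n} v = trans (det-zeroFirstRow (lower v) (λ j → refl)) (trans (*-identityˡ _) (SL-I {n}))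

  SL-upper : ∀ {n} (w : Fin n → Carrier) → SL (upper w)
  SL-upper {n} w = trans (det-zeroFirstColumn (upper w) (λ r → refl)) (trans (*-identityˡ _) (SL-I {n}))

  lower-*M-zero : ∀ {n} v (X : Mat (suc n)) s → (lower v *M X) zero s ≈ X zero s
  lower-*M-zero {n} v X s = trans (+-cong (*-identityˡ _) (Σ-≈0# {n} (λ l → zeroˡ _))) (+-identityʳ _)

  lower-*M-suc : ∀ {n} v (X : Mat (suc n)) r s → (lower v *M X) (suc r) s ≈ v r * X zero s + X (suc r) s
  lower-*M-suc v X r s = +-cong refl (Σ-selectˡ r (λ l → X (suc l) s))

  upper-*M-zero : ∀ {n} w (X : Mat (suc n)) s →
                  (upper w *M X) zero s ≈ X zero s + Σ[ n ] (λ l → w l * X (suc l) s)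
  upper-*M-zero w X s = +-cong (*-identityˡ _) refl

  upper-*M-suc : ∀ {n} w (X : Mat (suc n)) r s → (upper w *M X) (suc r) s ≈ X (suc r) s
  upper-*M-suc w X r s = trans (+-cong (zeroˡ _) (Σ-selectˡ r (λ l → X (suc l) s))) (+-identityˡ _)

  *M-upper-zero : ∀ {n} w (X : Mat (suc n)) r → (X *M upper w) r zero ≈ X r zero
  *M-upper-zero {n} w X r = trans (+-cong (*-identityʳ _) (Σ-≈0# {n} (λ l → zeroʳ _))) (+-identityʳ _)

  *M-upper-suc : ∀ {n} w (X : Mat (suc n)) r s → (X *M upper w) r (suc s) ≈ X r zero * w s + X r (suc s)
  *M-upper-suc w X r s = +-cong refl (Σ-selectʳ s (λ l → X r (suc l)))

  *M-lower-zero : ∀ {n} v (X : Mat (suc n)) r →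
                  (X *M lower v) r zero ≈ X r zero + Σ[ n ] (λ l → X r (suc l) * v l)
  *M-lower-zero v X r = +-cong (*-identityʳ _) refl

  scale : ∀ {n} → Carrier → Carrier → Mat (suc (suc n))
  scale x y = x ⊕ y ⊕ I

  SL-scale : ∀ {n} {x y} → x * y ≈ 1# → SL (scale {n} x y)
  SL-scale {n} {x} {y} xy≈1 = begin
    det (x ⊕ y ⊕ I {n})    ≈⟨ det-⊕ x (y ⊕ I {n}) ⟩
    x * det (y ⊕ I {n})    ≈⟨ *-cong refl (det-⊕ y (I {n})) ⟩
    x * (y * det (I {n}))  ≈⟨ *-cong refl (trans (*-cong refl (SL-I {n})) (*-identityʳ y)) ⟩
    x * y                  ≈⟨ xy≈1 ⟩
    1#                     ∎
    where open SetoidReasoning setoid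

  scale-*M : ∀ {n} x y a b (Y : Mat n) → (scale x y *M (a ⊕ b ⊕ Y)) ≈M ((x * a) ⊕ (y * b) ⊕ Y)
  scale-*M x y a b Y =
    ≈M-trans (⊕-*M x a (y ⊕ I) (b ⊕ Y))
             (⊕-cong refl (≈M-trans (⊕-*M y b I Y) (⊕-cong refl (*M-identityˡ Y))))

  Idempotent : ∀ {n} → Mat n → Set ℓ
  Idempotent A = (A *M A) ≈M A

  ^M-idempotent : ∀ {n} {A : Mat n} → Idempotent A → ∀ k → 1 ≤ k → (A ^M k) ≈M A
  ^M-idempotent {A = A} A²≈A (suc zero)    _ = *M-identityʳ A
  ^M-idempotent {A = A} A²≈A (suc (suc k)) _ =
    ≈M-trans (*M-cong ≈M-refl (^M-idempotent A²≈A (suc k) (s≤s z≤n))) A²≈A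

  0M : ∀ {n} → Mat n
  0M i j = 0#

  0M-idempotent : ∀ {n} → Idempotent (0M {n})
  0M-idempotent {n} i j = Σ-≈0# {n} (λ l → zeroˡ 0#)

  ⊕-idempotent : ∀ {n} {a} {A : Mat n} → a * a ≈ a → Idempotent A → Idempotent (a ⊕ A)
  ⊕-idempotent {a = a} {A} a²≈a A²≈A = ≈M-trans (⊕-*M a a A A) (⊕-cong a²≈a A²≈A)

  Is01 : Carrier → Set ℓ
  Is01 x = x ≈ 0# ⊎ x ≈ 1#

  Is01⇒idempotent : ∀ {x} → Is01 x → x * x ≈ x
  Is01⇒idempotent (inj₁ x≈0) = trans (*-cong x≈0 x≈0) (trans (zeroˡ 0#) (sym x≈0))
  Is01⇒idempotent (inj₂ x≈1) = trans (*-cong x≈1 x≈1) (trans (*-identityˡ 1#) (sym x≈1))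

  All01 : ∀ {n} → (Fin n → Carrier) → Set ℓ
  All01 e = ∀ i → Is01 (e i)

  All01-∷ : ∀ {n} {x} {e : Fin n → Carrier} → Is01 x → All01 e → All01 (x ∷ e)
  All01-∷ x∈01 e∈01 zero    = x∈01
  All01-∷ x∈01 e∈01 (suc i) = e∈01 i

  diag-idempotent : ∀ {n} {e : Fin n → Carrier} → All01 e → Idempotent (diag e)
  diag-idempotent {zero}  e∈01 ()
  diag-idempotent {suc n} e∈01 =
    ⊕-idempotent (Is01⇒idempotent (e∈01 zero)) (diag-idempotent (λ i → e∈01 (suc i)))

module Elimination {c ℓ : Level} (F : FiniteField c ℓ) where
  open FiniteField F hiding (zero)
  open Matrices F
  open MatrixAlgebra F
  open RingProperties ring using (-‿distribˡ-*)

  data Step {n} (X Y : Mat n) : Set (c ⊔ ℓ) where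
    row : (g : Mat n) → SL g → (g *M X) ≈M Y → Step X Y
    col : (h : Mat n) → SL h → (X *M h) ≈M Y → Step X Y

  infix 4 _⇝_
  _⇝_ : ∀ {n} → Mat n → Mat n → Set (c ⊔ ℓ)
  _⇝_ = Star Step

  ≈M⇒⇝ : ∀ {n} {X Y : Mat n} → X ≈M Y → X ⇝ Y
  ≈M⇒⇝ {n} {X} X≈Y = row I (SL-I {n}) (≈M-trans (*M-identityˡ X) X≈Y) ◅ ε

  ⊕-Step : ∀ {n} a {X Y : Mat n} → Step X Y → Step (a ⊕ X) (a ⊕ Y)
  ⊕-Step a {X} (row g g∈SL gX≈Y) =
    row (1# ⊕ g) (SL-1#⊕ g g∈SL) (≈M-trans (⊕-*M 1# a g X) (⊕-cong (*-identityˡ a) gX≈Y))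
  ⊕-Step a {X} (col h h∈SL Xh≈Y) =
    col (1# ⊕ h) (SL-1#⊕ h h∈SL) (≈M-trans (⊕-*M a 1# X h) (⊕-cong (*-identityʳ a) Xh≈Y))

  ⊕-⇝ : ∀ {n} a {X Y : Mat n} → X ⇝ Y → (a ⊕ X) ⇝ (a ⊕ Y)
  ⊕-⇝ a = gmap (a ⊕_) (⊕-Step a)

  zero⊎nonzero : ∀ {n} (M : Mat n) → (∀ i j → M i j ≈ 0#) ⊎ ∃₂ λ i j → ¬ M i j ≈ 0#
  zero⊎nonzero M with FinP.any? (λ i → FinP.any? (λ j → ¬? (M i j ≟ 0#)))
  ... | yes (i , j , Mij≉0) = inj₂ (i , j , Mij≉0)
  ... | no ∄nonzero = inj₁ λ i j →
    decidable-stable (M i j ≟ 0#) (λ Mij≉0 → ∄nonzero (i , j , Mij≉0))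

  nonzeroInFirstRow : ∀ {n} (M : Mat (suc n)) i j → ¬ M i j ≈ 0# →
                      ∃ λ N → M ⇝ N × ¬ N zero j ≈ 0#
  nonzeroInFirstRow M i j Mij≉0 with M zero j ≟ 0#
  ... | no M0j≉0 = M , ε , M0j≉0
  nonzeroInFirstRow M zero    j Mij≉0 | yes M0j≈0 = ⊥-elim (Mij≉0 M0j≈0)
  nonzeroInFirstRow M (suc i) j Mij≉0 | yes M0j≈0 =
    upper (I i) *M M , row (upper (I i)) (SL-upper (I i)) ≈M-refl ◅ ε , λ N0j≈0 → Mij≉0 (begin
      M (suc i) j                                    ≈⟨ +-identityˡ _ ⟨
      0# + M (suc i) j                               ≈⟨ +-cong M0j≈0 (Σ-selectˡ i (λ l → M (suc l) j)) ⟨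
      M zero j + Σ[ _ ] (λ l → I i l * M (suc l) j)  ≈⟨ upper-*M-zero (I i) M j ⟨
      (upper (I i) *M M) zero j                      ≈⟨ N0j≈0 ⟩
      0# ∎)
    where open SetoidReasoning setoid

  nonzeroAtOrigin : ∀ {n} (M : Mat (suc n)) j → ¬ M zero j ≈ 0# →
                    ∃ λ N → M ⇝ N × ¬ N zero zero ≈ 0#
  nonzeroAtOrigin M j M0j≉0 with M zero zero ≟ 0#
  ... | no M00≉0 = M , ε , M00≉0
  nonzeroAtOrigin M zero    M0j≉0 | yes M00≈0 = ⊥-elim (M0j≉0 M00≈0)
  nonzeroAtOrigin M (suc j) M0j≉0 | yes M00≈0 =
    M *M lower e , col (lower e) (SL-lower e) ≈M-refl ◅ ε , λ N00≈0 → M0j≉0 (begin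
      M zero (suc j)                                     ≈⟨ +-identityˡ _ ⟨
      0# + M zero (suc j)                                ≈⟨ +-cong M00≈0 (Σ-selectʳ j (λ l → M zero (suc l))) ⟨
      M zero zero + Σ[ _ ] (λ l → M zero (suc l) * e l)  ≈⟨ *M-lower-zero e M zero ⟨
      (M *M lower e) zero zero                           ≈⟨ N00≈0 ⟩
      0# ∎)
    where
    open SetoidReasoning setoid
    e : Fin _ → Carrier
    e l = I l j

  pivot : ∀ {n} (M : Mat (suc n)) i j → ¬ M i j ≈ 0# → ∃ λ N → M ⇝ N × ¬ N zero zero ≈ 0#
  pivot M i j Mij≉0 with nonzeroInFirstRow M i j Mij≉0
  ... | N , M⇝N , N0j≉0 with nonzeroAtOrigin N j N0j≉0
  ... | N′ , N⇝N′ , N′00≉0 = N′ , M⇝N ◅◅ N⇝N′ , N′00≉0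

  eliminates : ∀ {a a⁻¹} → a * a⁻¹ ≈ 1# → ∀ x → - (x * a⁻¹) * a + x ≈ 0#
  eliminates {a} {a⁻¹} aa⁻¹≈1 x = begin
    - (x * a⁻¹) * a + x  ≈⟨ +-cong (-‿distribˡ-* (x * a⁻¹) a) refl ⟨
    - (x * a⁻¹ * a) + x  ≈⟨ +-cong (-‿cong xa⁻¹a≈x) refl ⟩
    - x + x              ≈⟨ -‿inverseˡ x ⟩
    0# ∎
    where
    open SetoidReasoning setoid
    xa⁻¹a≈x : x * a⁻¹ * a ≈ x
    xa⁻¹a≈x = trans (*-assoc x a⁻¹ a) (trans (*-cong refl (trans (*-comm a⁻¹ a) aa⁻¹≈1)) (*-identityʳ x))

  clearFirstRowAndColumn : ∀ {n} (M : Mat (suc n)) → ¬ M zero zero ≈ 0# →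
                           ∃ λ M′ → M ⇝ (M zero zero ⊕ M′)
  clearFirstRowAndColumn {n} M a≉0 with inverse (M zero zero) a≉0
  ... | a⁻¹ , aa⁻¹≈1 =
    minor N , row (lower v) (SL-lower v) ≈M-refl ◅ col (upper u) (SL-upper u) NU≈a⊕minor ◅ ε
    where
    a : Carrier
    a = M zero zero
    v : Fin n → Carrier
    v r = - (M (suc r) zero * a⁻¹)
    N : Mat (suc n)
    N = lower v *M M
    u : Fin n → Carrier
    u s = - (N zero (suc s) * a⁻¹)
    N-zero : ∀ s → N zero s ≈ M zero s
    N-zero = lower-*M-zero v M
    N-column : ∀ r → N (suc r) zero ≈ 0#
    N-column r = trans (lower-*M-suc v M r zero) (eliminates aa⁻¹≈1 (M (suc r) zero))
    NU≈a⊕minor : (N *M upper u) ≈M (a ⊕ minor N)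
    NU≈a⊕minor zero    zero    = trans (*M-upper-zero u N zero) (N-zero zero)
    NU≈a⊕minor zero    (suc s) = trans (*M-upper-suc u N zero s)
      (trans (+-cong (trans (*-cong (N-zero zero) refl) (*-comm a (u s))) refl)
             (eliminates aa⁻¹≈1 (N zero (suc s))))
    NU≈a⊕minor (suc r) zero    = trans (*M-upper-zero u N (suc r)) (N-column r)
    NU≈a⊕minor (suc r) (suc s) = trans (*M-upper-suc u N (suc r) s)
      (trans (+-cong (trans (*-cong (N-column r) refl) (zeroˡ _)) refl) (+-identityˡ _))

  peel : ∀ {n} (M : Mat (suc n)) → ∃₂ λ a M′ → M ⇝ (a ⊕ M′)
  peel M with zero⊎nonzero M
  ... | inj₁ M≈0 = 0# , minor M , ≈M⇒⇝ M≈0⊕minor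
    where
    M≈0⊕minor : M ≈M (0# ⊕ minor M)
    M≈0⊕minor zero    zero    = M≈0 zero zero
    M≈0⊕minor zero    (suc s) = M≈0 zero (suc s)
    M≈0⊕minor (suc r) zero    = M≈0 (suc r) zero
    M≈0⊕minor (suc r) (suc s) = refl
  ... | inj₂ (i , j , Mij≉0) with pivot M i j Mij≉0
  ... | N , M⇝N , N00≉0 with clearFirstRowAndColumn N N00≉0
  ... | M′ , N⇝N00⊕M′ = N zero zero , M′ , M⇝N ◅◅ N⇝N00⊕M′

  normalForm : ∀ {n} (M : Mat (suc n)) →
               ∃₂ λ d (e : Fin n → Carrier) → All01 e × M ⇝ (d ⊕ diag e)
  normalForm {zero} M = M zero zero , (λ ()) , (λ ()) , ≈M⇒⇝ M≈M00⊕[]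
    where
    M≈M00⊕[] : M ≈M (M zero zero ⊕ diag (λ ()))
    M≈M00⊕[] zero zero = refl
  normalForm {suc n} M with peel M
  ... | a , M′ , M⇝a⊕M′ with normalForm M′
  ... | d , e , e∈01 , M′⇝d⊕De with d ≟ 0#
  ... | yes d≈0 = a , 0# ∷ e , All01-∷ (inj₁ refl) e∈01 ,
    M⇝a⊕M′ ◅◅ ⊕-⇝ a M′⇝d⊕De ◅◅ ≈M⇒⇝ (⊕-cong refl (⊕-cong d≈0 ≈M-refl))
  ... | no d≉0 with inverse d d≉0
  ... | d⁻¹ , dd⁻¹≈1 = d * a , 1# ∷ e , All01-∷ (inj₂ refl) e∈01 ,
    M⇝a⊕M′ ◅◅ ⊕-⇝ a M′⇝d⊕De ◅◅
      row (scale d d⁻¹) (SL-scale {n} dd⁻¹≈1)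
          (≈M-trans (scale-*M d d⁻¹ a d (diag e)) (⊕-cong refl (⊕-cong (trans (*-comm d⁻¹ d) dd⁻¹≈1) ≈M-refl)))
      ◅ ε


-- diag(d, 1) = [[1, -1], [0, 1]] [[1, 0], [-d′, 1]] (diag(0, 1) + R) with d′ = 1 - d,
-- where R = [[d, 1], [d′d, d′]] is idempotent (trace d + d′ = 1, determinant 0).
module Factorisation {c ℓ : Level} (F : FiniteField c ℓ)
                     (d : FiniteField.Carrier F) {m : ℕ} (Z : Matrices.Mat F m) where
  open FiniteField F hiding (zero)
  open Matrices F
  open MatrixAlgebra F
  open RingProperties ring using (-‿distribˡ-*; -1*x≈-x)

  d′ : Carrier
  d′ = 1# - d

  E R : Mat (suc (suc m))
  E = 0# ⊕ 1# ⊕ Z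
  R zero       zero       = d
  R zero       (suc zero) = 1#
  R (suc zero) zero       = d′ * d
  R (suc zero) (suc zero) = d′
  R _          _          = 0#

  v u : Fin (suc m) → Carrier
  v = - d′ ∷ λ _ → 0#
  u = - 1# ∷ λ _ → 0#

  E-idempotent : Idempotent Z → Idempotent E
  E-idempotent Z²≈Z = ⊕-idempotent (zeroˡ 0#) (⊕-idempotent (*-identityˡ 1#) Z²≈Z)

  d+d′≈1 : d + d′ ≈ 1#
  d+d′≈1 = trans (+-comm d d′) (trans (+-assoc 1# (- d) d) (trans (+-cong refl (-‿inverseˡ d)) (+-identityʳ 1#)))

  [d+d′]*x≈x : ∀ x → (d + d′) * x ≈ x
  [d+d′]*x≈x x = trans (*-cong d+d′≈1 refl) (*-identityˡ x)

  R-lastColumns : ∀ i l → R i (suc (suc l)) ≈ 0#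
  R-lastColumns zero          l = refl
  R-lastColumns (suc zero)    l = refl
  R-lastColumns (suc (suc r)) l = refl

  R² : ∀ i j → (R *M R) i j ≈ R i zero * R zero j + R i (suc zero) * R (suc zero) j
  R² i j = +-cong refl (trans (+-cong refl (Σ-≈0# {m} (λ l → trans (*-cong (R-lastColumns i l) refl) (zeroˡ _))))
                              (+-identityʳ _))

  R-idempotent : Idempotent R
  R-idempotent i j = trans (R² i j) (entry i j)
    where
    entry : ∀ i j → R i zero * R zero j + R i (suc zero) * R (suc zero) j ≈ R i j
    entry zero          zero          =
      trans (+-cong refl (*-identityˡ _)) (trans (sym (distribʳ d d d′)) ([d+d′]*x≈x d))
    entry zero          (suc zero)    = trans (+-cong (*-identityʳ d) (*-identityˡ d′)) d+d′≈1
    entry zero          (suc (suc s)) = trans (+-cong (zeroʳ d) (zeroʳ 1#)) (+-identityʳ 0#)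
    entry (suc zero)    zero          = trans (+-cong (*-comm (d′ * d) d) refl)
      (trans (sym (distribʳ (d′ * d) d d′)) ([d+d′]*x≈x (d′ * d)))
    entry (suc zero)    (suc zero)    = trans (+-cong (trans (*-identityʳ _) (*-comm d′ d)) refl)
      (trans (sym (distribʳ d′ d d′)) ([d+d′]*x≈x d′))
    entry (suc zero)    (suc (suc s)) = trans (+-cong (zeroʳ _) (zeroʳ d′)) (+-identityʳ 0#)
    entry (suc (suc r)) j             = trans (+-cong (zeroˡ _) (zeroˡ _)) (+-identityʳ 0#)

  T S LS : Mat (suc (suc m))
  T  = d ⊕ 1# ⊕ Z
  S  = E +M R
  LS = lower v *M S

  LS-secondRow : ∀ s → LS (suc zero) s ≈ T (suc zero) s
  LS-secondRow s = trans (lower-*M-suc v S zero s) (entry s)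
    where
    entry : ∀ s → - d′ * S zero s + S (suc zero) s ≈ T (suc zero) s
    entry zero          = trans (+-cong (trans (*-cong refl (+-identityˡ d)) (sym (-‿distribˡ-* d′ d)))
                                        (+-identityˡ _))
                                (-‿inverseˡ (d′ * d))
    entry (suc zero)    = trans (+-cong (trans (*-cong refl (+-identityˡ 1#)) (*-identityʳ _)) refl)
      (trans (+-comm (- d′) _) (trans (+-assoc 1# d′ (- d′)) (trans (+-cong refl (-‿inverseʳ d′)) (+-identityʳ 1#))))
    entry (suc (suc s)) = trans (+-cong (trans (*-cong refl (+-identityˡ 0#)) (zeroʳ _)) (+-identityˡ 0#))
                                (+-identityˡ 0#)

  LS-lowerRows : ∀ r s → LS (suc (suc r)) s ≈ S (suc (suc r)) s
  LS-lowerRows r s = trans (lower-*M-suc v S (suc r) s) (trans (+-cong (zeroˡ _) refl) (+-identityˡ _))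

  upper-lower-[E+R]≈d⊕1⊕Z : (upper u *M (lower v *M (E +M R))) ≈M (d ⊕ 1# ⊕ Z)
  upper-lower-[E+R]≈d⊕1⊕Z zero j = begin
    (upper u *M LS) zero j                                                   ≈⟨ upper-*M-zero u LS j ⟩
    LS zero j + (- 1# * LS (suc zero) j + Σ[ m ] (λ l → 0# * LS (suc (suc l)) j))
      ≈⟨ +-cong (lower-*M-zero v S j) (+-cong (*-cong refl (LS-secondRow j)) (Σ-≈0# {m} (λ l → zeroˡ _))) ⟩
    S zero j + (- 1# * T (suc zero) j + 0#)   ≈⟨ +-cong refl (trans (+-identityʳ _) (-1*x≈-x _)) ⟩
    S zero j - T (suc zero) j                 ≈⟨ entry j ⟩
    T zero j                                  ∎
    where
    open SetoidReasoning setoid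
    entry : ∀ j → S zero j - T (suc zero) j ≈ T zero j
    entry zero          = trans (x-0#≈x _) (+-identityˡ d)
    entry (suc zero)    = trans (+-cong (+-identityˡ 1#) refl) (-‿inverseʳ 1#)
    entry (suc (suc s)) = trans (x-0#≈x _) (+-identityˡ 0#)
  upper-lower-[E+R]≈d⊕1⊕Z (suc zero) j = trans (upper-*M-suc u LS zero j) (LS-secondRow j)
  upper-lower-[E+R]≈d⊕1⊕Z (suc (suc r)) j =
    trans (upper-*M-suc u LS (suc r) j) (trans (LS-lowerRows r j) (entry j))
    where
    entry : ∀ j → S (suc (suc r)) j ≈ T (suc (suc r)) j
    entry zero          = +-identityˡ 0#
    entry (suc zero)    = +-identityˡ 0#
    entry (suc (suc s)) = +-identityʳ (Z r s)

module SumsOfPowers {c ℓ : Level} (F : FiniteField c ℓ) (k : ℕ) where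
  open FiniteField F hiding (zero)
  open Matrices F
  open MatrixAlgebra F
  open Elimination F

  P-resp-≈M : ∀ {n} {X Y : Mat n} → X ≈M Y → P k Y → P k X
  P-resp-≈M X≈Y (A , B , Y≈Aᵏ+Bᵏ) = A , B , ≈M-trans X≈Y Y≈Aᵏ+Bᵏ

  P-conj : ∀ {n} {h h′ : Mat n} → (h *M h′) ≈M I → (h′ *M h) ≈M I →
           ∀ {Y} → P k Y → P k (h′ *M (Y *M h))
  P-conj {n} {h} {h′} hh′≈I h′h≈I {Y} (A , B , Y≈Aᵏ+Bᵏ) = h′ *M (A *M h) , h′ *M (B *M h) , (begin
    h′ *M (Y *M h)                                       ≈⟨ *M-cong ≈M-refl (*M-cong Y≈Aᵏ+Bᵏ ≈M-refl) ⟩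
    h′ *M (((A ^M k) +M (B ^M k)) *M h)                  ≈⟨ *M-cong ≈M-refl (*M-distribʳ-+M h _ _) ⟩
    h′ *M (((A ^M k) *M h) +M ((B ^M k) *M h))           ≈⟨ *M-distribˡ-+M h′ _ _ ⟩
    (h′ *M ((A ^M k) *M h)) +M (h′ *M ((B ^M k) *M h))
      ≈⟨ +M-cong (^M-conj hh′≈I h′h≈I A k) (^M-conj hh′≈I h′h≈I B k) ⟨
    ((h′ *M (A *M h)) ^M k) +M ((h′ *M (B *M h)) ^M k)   ∎)
    where open SetoidReasoning (≈M-setoid n)

  P-+-idempotent : 1 ≤ k → ∀ {n} {A B : Mat n} → Idempotent A → Idempotent B → P k (A +M B)
  P-+-idempotent k≥1 {A = A} {B} A²≈A B²≈B =
    A , B , +M-cong (≈M-sym (^M-idempotent A²≈A k k≥1)) (≈M-sym (^M-idempotent B²≈B k k≥1))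

  P-idempotent : 1 ≤ k → ∀ {n} {A : Mat n} → Idempotent A → P k A
  P-idempotent k≥1 A²≈A =
    P-resp-≈M (λ i j → sym (+-identityʳ _)) (P-+-idempotent k≥1 A²≈A 0M-idempotent)

  module Invariance {n} (SL⊆L : ∀ (g : Mat n) → SL g → L (P k) g) where

    P-left-closed : ∀ g → SL g → ∀ {X} → P k X → P k (g *M X)
    P-left-closed g g∈SL {X} X∈P with SL⊆L g g∈SL
    ... | _ , gP⊆P , _ with gP⊆P X X∈P
    ... | Y , Y∈P , gX≈Y = P-resp-≈M gX≈Y Y∈P

    P-left-cancel : ∀ g → SL g → ∀ {X} → P k (g *M X) → P k X
    P-left-cancel g g∈SL {X} gX∈P with SL⊆L g g∈SL
    ... | (_ , _ , g⁻¹g≈I) , _ , P⊆gP with P⊆gP (g *M X) gX∈P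
    ... | Y , Y∈P , gY≈gX = P-resp-≈M (*M-cancelˡ g⁻¹g≈I (≈M-sym gY≈gX)) Y∈P

    P-right-cancel : ∀ h → SL h → ∀ {X} → P k (X *M h) → P k X
    P-right-cancel h h∈SL {X} Xh∈P with SL⊆L h h∈SL
    ... | (h⁻¹ , hh⁻¹≈I , h⁻¹h≈I) , _ =
      P-left-cancel h h∈SL (P-resp-≈M (*M-cong ≈M-refl Xhh⁻¹≈X) (P-conj h⁻¹h≈I hh⁻¹≈I Xh∈P))
      where
      Xhh⁻¹≈X : X ≈M ((X *M h) *M h⁻¹)
      Xhh⁻¹≈X = ≈M-sym (≈M-trans (*M-assoc X h h⁻¹) (≈M-trans (*M-cong ≈M-refl hh⁻¹≈I) (*M-identityʳ X)))

    P-reflects-⇝ : ∀ {X Y} → X ⇝ Y → P k Y → P k X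
    P-reflects-⇝ ε                            Y∈P = Y∈P
    P-reflects-⇝ (row g g∈SL gX≈Z ◅ Z⇝Y) Y∈P =
      P-left-cancel g g∈SL (P-resp-≈M gX≈Z (P-reflects-⇝ Z⇝Y Y∈P))
    P-reflects-⇝ (col h h∈SL Xh≈Z ◅ Z⇝Y) Y∈P =
      P-right-cancel h h∈SL (P-resp-≈M Xh≈Z (P-reflects-⇝ Z⇝Y Y∈P))

  module _ {m} (SL⊆L : ∀ (g : Mat (suc (suc m))) → SL g → L (P k) g) (k≥1 : 1 ≤ k) where
    open Invariance SL⊆L

    d⊕0⊕Z∈P : ∀ d {Z : Mat m} → Idempotent Z → P k (d ⊕ 0# ⊕ Z)
    d⊕0⊕Z∈P d {Z} Z²≈Z with d ≟ 0#
    ... | yes d≈0 = P-resp-≈M (⊕-cong d≈0 ≈M-refl) (P-idempotent k≥1 0⊕0⊕Z-idempotent)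
      where
      0⊕0⊕Z-idempotent : Idempotent (0# ⊕ 0# ⊕ Z)
      0⊕0⊕Z-idempotent = ⊕-idempotent (zeroˡ 0#) (⊕-idempotent (zeroˡ 0#) Z²≈Z)
    ... | no d≉0 with inverse d d≉0
    ... | d⁻¹ , dd⁻¹≈1 =
      P-resp-≈M d⊕0⊕Z≈scaled
        (P-left-closed (scale d d⁻¹) (SL-scale {m} dd⁻¹≈1) (P-idempotent k≥1 1⊕0⊕Z-idempotent))
      where
      1⊕0⊕Z-idempotent : Idempotent (1# ⊕ 0# ⊕ Z)
      1⊕0⊕Z-idempotent = ⊕-idempotent (*-identityˡ 1#) (⊕-idempotent (zeroˡ 0#) Z²≈Z)
      d⊕0⊕Z≈scaled : (d ⊕ 0# ⊕ Z) ≈M (scale d d⁻¹ *M (1# ⊕ 0# ⊕ Z))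
      d⊕0⊕Z≈scaled = ≈M-sym (≈M-trans (scale-*M d d⁻¹ 1# 0# Z)
                                       (⊕-cong (*-identityʳ d) (⊕-cong (zeroʳ d⁻¹) ≈M-refl)))

    d⊕1⊕Z∈P : ∀ d {Z : Mat m} → Idempotent Z → P k (d ⊕ 1# ⊕ Z)
    d⊕1⊕Z∈P d {Z} Z²≈Z =
      P-resp-≈M (≈M-sym upper-lower-[E+R]≈d⊕1⊕Z)
        (P-left-closed (upper u) (SL-upper u)
          (P-left-closed (lower v) (SL-lower v) (P-+-idempotent k≥1 (E-idempotent Z²≈Z) R-idempotent)))
      where open Factorisation F d Z

    d⊕diag∈P : ∀ d {e : Fin (suc m) → Carrier} → All01 e → P k (d ⊕ diag e)
    d⊕diag∈P d {e} e∈01 with e∈01 zero | diag-idempotent (λ i → e∈01 (suc i))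
    ... | inj₁ e₀≈0 | tail-idempotent =
      P-resp-≈M (⊕-cong refl (⊕-cong e₀≈0 ≈M-refl)) (d⊕0⊕Z∈P d tail-idempotent)
    ... | inj₂ e₀≈1 | tail-idempotent =
      P-resp-≈M (⊕-cong refl (⊕-cong e₀≈1 ≈M-refl)) (d⊕1⊕Z∈P d tail-idempotent)

    every∈P : ∀ M → P k M
    every∈P M with normalForm M
    ... | d , e , e∈01 , M⇝d⊕De = P-reflects-⇝ M⇝d⊕De (d⊕diag∈P d e∈01)

proposition3p3 : ∀ {c ℓ : Level} (F : FiniteField c ℓ) (n k : ℕ) → 2 ≤ n → 1 ≤ k →
    let open Matrices F in
    (∀ (g : Mat n) → SL g → L (P k) g) →
    ∀ (M : Mat n) → P k M
proposition3p3 F (suc (suc m)) k (s≤s (s≤s z≤n)) k≥1 SL⊆L = SumsOfPowers.every∈P F k SL⊆L k≥1
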